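{- Let $S$ be a variable preserving term equation system over a ranked alphabet $\Sigma$, let $p,q\in T_\Sigma$, and let $W_i$ ($i\ge1$) be the ground term equation systems defined in the context. For each $i\ge1$, the GTES $W_i$ can be effectively constructed (from $S$, $p$, $q$ and $i$).
   Context: Notation. $\Sigma$ is a ranked alphabet ($\Sigma_m$: symbols of rank $m$), $T_\Sigma$ the ground terms, $X_m=\{x_1,\dots,x_m\}$, $T_\Sigma(X_m)$ terms with variables in $X_m$; $t[t_1,\dots,t_m]$ replaces each $x_j$ by $t_j$. A context is a term $u\in T_\Sigma(X_1)$ with exactly one occurrence of $x_1$; $u[s]$ replaces $x_1$ by $s$. A TES $S$ is a finite set of equations $l\approx r$ of terms; it is variable preserving if $l$ and $r$ contain the same variables in each equation, which is then written with $l,r\in T_\Sigma(X_m)$. A ground term equation system (GTES) $E$ is a finite set of equations between ground terms; $\Leftrightarrow^*_E$ is the congruence on $T_\Sigma$ generated by $E$ (reflexive transitive closure of replacing, inside a context, an instance... i.e. one side of an equation of $E$ by the other). Congruence class computing tree automaton associated with a GTES $E$ and ground terms $p,q$: $T$ is the set of all subterms of $p$, $q$ and of both sides of all equations of $E$; $\Theta=\Leftrightarrow^*_E\cap(T\times T)$ with classes $[t]_\Theta$; states $A=\{[t]_\Theta:t\in T\}$ (new constants); rules $R=\{f([t_1]_\Theta,\dots,[t_m]_\Theta)\to[f(t_1,\dots,t_m)]_\Theta : f(t_1,\dots,t_m)\in T\}$; $\to^*_R$ is rewriting with $R$ on terms over $\Sigma\cup A$. For each $a\in A$ a ground term $tree(a)\in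 T_\Sigma$ with $tree(a)\to^*_R a$ is fixed (computed by a fixed deterministic effective algorithm). The automaton reaches $b$ starting from $c$ if $u[c]\to^*_R b$ for some context $u$ ($u=x_1$ allowed). $W_1$ is the set of ground equations $l[u_1,\dots,u_m]\approx r[u_1,\dots,u_m]$ ($l\approx r\in S$, $u_j\in T_\Sigma$) such that $l[u_1,\dots,u_m]$ or $r[u_1,\dots,u_m]$ is a subterm of $p$ or of $q$. For $i\ge1$, with $A_i,R_i,\Theta_i,tree_i$ the data of the automaton associated with the GTES $W_i$ and $p,q$, $W_{i+1}$ consists of $W_i$ together with every equation $l[tree_i(a_1),\dots,tree_i(a_m)]\approx r[tree_i(a_1),\dots,tree_i(a_m)]$ with $l\approx r\in S$, $a_1,\dots,a_m,a\in A_i$ such that (1) $l[a_1,\dots,a_m]\to^*_{R_i}a$ or $r[a_1,\dots,a_m]\to^*_{R_i}a$, (2) the automaton reaches $[p]_{\Theta_i}$ or $[q]_{\Theta_i}$ starting from $a$, (3) the pair of the two sides is not in $\Leftrightarrow^*_{W_i}$. -}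

module Defs where

open import Data.Nat using (ℕ; zero; suc)
open import Data.Fin using (Fin; zero; suc)
open import Data.Vec using (Vec; []; _∷_; lookup; map)
open import Data.Vec.Relation.Unary.Any using (Any)
open import Data.Vec.Relation.Unary.All using (All)
open import Data.Vec.Relation.Binary.Pointwise.Inductive using (Pointwise)
open import Data.List using (List)
import Data.List.Membership.Propositional as LM
open import Data.Product using (Σ; ∃; _×_; _,_; proj₁; proj₂; ∃-syntax)
open import Data.Sum using (_⊎_)
open import Relation.Binary.PropositionalEquality using (_≡_)
open import Relation.Binary.Construct.Closure.ReflexiveTransitive using (Star)
open import Relation.Nullary using (¬_)
open import Function.Bundles using (_⇔_)

record RankedAlphabet : Set where
  field
    size : ℕ
    rank : Fin size → ℕ
open RankedAlphabet public

-- Terms over the alphabet with leaves from L (variables, or states).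
data Tm (Sig : RankedAlphabet) (L : Set) : Set where
  leaf : L → Tm Sig L
  node : (f : Fin (size Sig)) → Vec (Tm Sig L) (rank Sig f) → Tm Sig L

GT : RankedAlphabet → Set
GT Sig = Tm Sig (Fin 0)

GEq : RankedAlphabet → Set
GEq Sig = GT Sig × GT Sig

GTES : RankedAlphabet → Set
GTES Sig = List (GEq Sig)

Eqn : RankedAlphabet → Set
Eqn Sig = Σ ℕ λ m → Tm Sig (Fin m) × Tm Sig (Fin m)

TES : RankedAlphabet → Set
TES Sig = List (Eqn Sig)

module _ {Sig : RankedAlphabet} where

  mutual
    _⟪_⟫ : ∀ {L M : Set} → Tm Sig L → (L → Tm Sig M) → Tm Sig M
    leaf x ⟪ σ ⟫ = σ x
    node f ts ⟪ σ ⟫ = node f (ts ⟪ σ ⟫*)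

    _⟪_⟫* : ∀ {L M : Set} {k} → Vec (Tm Sig L) k → (L → Tm Sig M) → Vec (Tm Sig M) k
    [] ⟪ σ ⟫* = []
    (t ∷ ts) ⟪ σ ⟫* = (t ⟪ σ ⟫) ∷ (ts ⟪ σ ⟫*)

  inst : ∀ {m} {M : Set} → Tm Sig (Fin m) → Vec (Tm Sig M) m → Tm Sig M
  inst t us = t ⟪ lookup us ⟫

  mutual
    leaves : ∀ {L : Set} → Tm Sig L → ℕ
    leaves (leaf _) = 1
    leaves (node f ts) = leaves* ts

    leaves* : ∀ {L : Set} {k} → Vec (Tm Sig L) k → ℕ
    leaves* [] = 0
    leaves* (t ∷ ts) = leaves t Data.Nat.+ leaves* ts

  data Occurs {L : Set} (x : L) : Tm Sig L → Set where
    here  : Occurs x (leaf x)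
    there : ∀ {f ts} → Any (Occurs x) ts → Occurs x (node f ts)

  data _⊑_ (s : GT Sig) : GT Sig → Set where
    self : s ⊑ s
    sub  : ∀ {f ts} → Any (s ⊑_) ts → s ⊑ node f ts

  Context : Set
  Context = Σ (Tm Sig (Fin 1)) λ u → leaves u ≡ 1

  plug : ∀ {M : Set} → Context → Tm Sig M → Tm Sig M
  plug (u , _) s = u ⟪ (λ _ → s) ⟫

  embed : ∀ {M : Set} → GT Sig → Tm Sig M
  embed t = t ⟪ (λ ()) ⟫

  Step : GTES Sig → GT Sig → GT Sig → Set
  Step E s t = ∃[ c ] ∃[ e ] (e LM.∈ E) ×
    ((s ≡ plug c (proj₁ e) × t ≡ plug c (proj₂ e)) ⊎
     (s ≡ plug c (proj₂ e) × t ≡ plug c (proj₁ e)))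

  Conv : GTES Sig → GT Sig → GT Sig → Set
  Conv E = Star (Step E)

  InT : GTES Sig → GT Sig → GT Sig → GT Sig → Set
  InT E p q t = t ⊑ p ⊎ t ⊑ q ⊎
    (∃[ e ] (e LM.∈ E) × (t ⊑ proj₁ e ⊎ t ⊑ proj₂ e))

  -- States [t]_Θ (t ∈ T) are represented by the representative t; a term
  -- over Σ ∪ A is an element of Tm Sig (GT Sig) whose leaf t stands for the
  -- state [t]_Θ.  Reach E p q u t  means  u →*_R [t]_Θ.
  data Reach (E : GTES Sig) (p q : GT Sig) : Tm Sig (GT Sig) → GT Sig → Set where
    st : ∀ {s t} → InT E p q s → InT E p q t → Conv E s t → Reach E p q (leaf s) t
    nd : ∀ {f us t} (ts : Vec (GT Sig) (rank Sig f)) →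
         Pointwise (Reach E p q) us ts →
         InT E p q (node f ts) → InT E p q t → Conv E (node f ts) t →
         Reach E p q (node f us) t

  ReachesFrom : GTES Sig → GT Sig → GT Sig → GT Sig → GT Sig → Set
  ReachesFrom E p q c b = ∃[ u ] Reach E p q (plug u (leaf c)) b

  VarPreserving : TES Sig → Set
  VarPreserving S = ∀ {eq} → eq LM.∈ S →
    ∀ (j : Fin (proj₁ eq)) → Occurs j (proj₁ (proj₂ eq)) ⇔ Occurs j (proj₂ (proj₂ eq))

  Selector : Set
  Selector = GTES Sig → GT Sig → GT Sig → GT Sig → GT Sig

  -- admissible selection: tree(a) →*_R a, and tree(a) depends only on the
  -- state a (i.e. on the set E and the class of t)
  ValidSel : Selector → Set
  ValidSel sel =
    (∀ E p q t → InT E p q t → Reach E p q (embed (sel E p q t)) t) ×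
    (∀ E E' p q t t' → (∀ e → (e LM.∈ E) ⇔ (e LM.∈ E')) →
       InT E p q t → InT E p q t' → Conv E t t' → sel E p q t ≡ sel E' p q t')

  SubPQ : GT Sig → GT Sig → GT Sig → Set
  SubPQ p q t = t ⊑ p ⊎ t ⊑ q

  InW₁ : TES Sig → GT Sig → GT Sig → GEq Sig → Set
  InW₁ S p q e = ∃[ eq ] (eq LM.∈ S) × ∃[ us ]
    (e ≡ (inst (proj₁ (proj₂ eq)) us , inst (proj₂ (proj₂ eq)) us)) ×
    (SubPQ p q (inst (proj₁ (proj₂ eq)) us) ⊎ SubPQ p q (inst (proj₂ (proj₂ eq)) us))

  NewEq : Selector → TES Sig → GT Sig → GT Sig → GTES Sig → GEq Sig → Set
  NewEq sel S p q Wi e = ∃[ eq ] (eq LM.∈ S) ×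
    ∃[ as ] ∃[ a ] All (InT Wi p q) as × InT Wi p q a ×
    (Reach Wi p q (proj₁ (proj₂ eq) ⟪ (λ j → leaf (lookup as j)) ⟫) a ⊎
     Reach Wi p q (proj₂ (proj₂ eq) ⟪ (λ j → leaf (lookup as j)) ⟫) a) ×
    (ReachesFrom Wi p q a p ⊎ ReachesFrom Wi p q a q) ×
    ¬ Conv Wi (inst (proj₁ (proj₂ eq)) (map (sel Wi p q) as))
              (inst (proj₂ (proj₂ eq)) (map (sel Wi p q) as)) ×
    (e ≡ (inst (proj₁ (proj₂ eq)) (map (sel Wi p q) as) ,
          inst (proj₂ (proj₂ eq)) (map (sel Wi p q) as)))

{-# OPTIONS --safe #-}
-- Each W_{i+1} is W_i extended by a finite, decidable selection of equations.
-- The congruence ⇔*_E is decidable by congruence closure: saturating the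
-- finite set T of subterms under the congruence rules yields Θ = ⇔*_E ∩ T×T,
-- and normalising ground terms bottom-up, replacing a node by the chosen
-- representative of its Θ-class as soon as it matches an f-node of T,
-- produces a normal form that characterises the ⇔*_E-class.  The automaton's
-- runs are then decidable by recursion on the input term, and the states
-- reached from a state c are the closure of {c} under its transitions, again
-- computed by saturation.  All remaining quantifiers range over finitely many
-- states; for W_1, variable preservation allows restricting the substitutions
-- to subterms of p and q.
module Submission where

open import Defs
open import Data.Nat using (ℕ; zero; suc; _+_; _≤_; _<_)
open import Data.Nat.Properties using (≤-refl; ≤-pred; <-≤-trans; +-identityʳ)
open import Data.Fin using (Fin; zero; suc)
import Data.Fin as Fin
open import Data.Vec using (Vec; []; _∷_; lookup; tabulate; _[_]≔_)
import Data.Vec as Vec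
open import Data.Vec.Properties using (lookup∘tabulate)
open import Data.Vec.Relation.Unary.All.Properties using (lookup⁻)
open import Data.Vec.Membership.Propositional.Properties using (∈-lookup)
open import Data.Vec.Relation.Unary.Any using (here; there)
import Data.Vec.Relation.Unary.Any as VAny
open import Data.Vec.Relation.Unary.All using ([]; _∷_)
import Data.Vec.Relation.Unary.All as VAll
open import Data.Vec.Relation.Binary.Pointwise.Inductive using (Pointwise; []; _∷_)
import Data.Vec.Relation.Binary.Pointwise.Inductive as Pointwise
import Data.Vec.Membership.Propositional as VecMembership
open import Data.List
  using (List; []; _∷_; [_]; _++_; concatMap; filter; length; cartesianProduct; cartesianProductWith)
import Data.List as List
open import Data.List.Properties using (filter-notAll)
open import Data.List.Relation.Unary.Any using (Any; here; there; any?)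
import Data.List.Relation.Unary.Any as Any
open import Data.List.Relation.Unary.Any.Properties using (++↔)
open import Data.List.Relation.Unary.All using (All; []; _∷_)
import Data.List.Relation.Unary.All as All
open import Data.List.Membership.Propositional using (_∈_; lose; find)
open import Data.List.Membership.Propositional.Properties
  using (∈-++⁺ˡ; ∈-++⁺ʳ; ∈-++⁻; ∈-concatMap⁺; ∈-concatMap⁻; ∈-filter⁺; ∈-filter⁻;
         ∈-map∘filter⁺; ∈-map∘filter⁻; ∈-cartesianProduct⁺; ∈-cartesianProduct⁻;
         ∈-cartesianProductWith⁺)
import Data.List.Membership.DecPropositional as DecMembership
open import Data.Product using (_×_; _,_; proj₁; proj₂; ∃-syntax; Σ-syntax)
open import Data.Product.Properties using (≡-dec)
open import Data.Sum using (_⊎_; inj₁; inj₂; [_,_]′)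
import Data.Sum as Sum
open import Data.Sum.Function.Propositional using (_⊎-⇔_)
open import Function using (id; _∘_; case_of_)
open import Function.Bundles using (_⇔_; mk⇔; Equivalence)
import Function.Properties.Equivalence as ⇔
open import Function.Properties.Inverse using (↔⇒⇔)
open import Relation.Nullary using (¬_; Dec; yes; no; ¬?; contradiction)
open import Relation.Nullary.Decidable using (_⊎-dec_; _×-dec_)
open import Relation.Unary using (Decidable)
open import Relation.Binary.Definitions using (DecidableEquality)
open import Relation.Binary.PropositionalEquality
  using (_≡_; refl; sym; trans; cong; cong₂; subst; module ≡-Reasoning)
open import Relation.Binary.Construct.Closure.ReflexiveTransitive
  using (ε; _◅_; _◅◅_; gmap; reverse)

vectorsOver : {A : Set} → List A → (m : ℕ) → List (Vec A m)
vectorsOver xs zero    = [ [] ]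
vectorsOver xs (suc m) = cartesianProductWith _∷_ xs (vectorsOver xs m)

∈-vectorsOver : ∀ {A : Set} {xs : List A} {m} {v : Vec A m} →
                VAll.All (_∈ xs) v → v ∈ vectorsOver xs m
∈-vectorsOver []       = here refl
∈-vectorsOver (x∈ ∷ v∈) = ∈-cartesianProductWith⁺ _∷_ x∈ (∈-vectorsOver v∈)

module Collect {A C : Set} {B : A → Set} (candidates : (a : A) → List (B a))
               (f : (a : A) → B a → C) {P : (a : A) → B a → Set}
               (P? : ∀ a → Decidable (P a)) where

  collect : List A → List C
  collect = concatMap λ a → List.map (f a) (filter (P? a) (candidates a))

  ∈-collect⁻ : ∀ {as c} → c ∈ collect as → ∃[ a ] a ∈ as × ∃[ b ] c ≡ f a b × P a b
  ∈-collect⁻ {as} c∈ with a , a∈ , c∈′ ← find (∈-concatMap⁻ _ {xs = as} c∈)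
                     with b , _ , c≡ , pb ← ∈-map∘filter⁻ (f a) (P? a) {xs = candidates a} c∈′
    = a , a∈ , b , c≡ , pb

  ∈-collect⁺ : ∀ {as a b} → a ∈ as → b ∈ candidates a → P a b → f a b ∈ collect as
  ∈-collect⁺ {a = a} a∈ b∈ pb =
    ∈-concatMap⁺ _ (lose a∈ (∈-map∘filter⁺ (f a) (P? a) (_ , b∈ , refl , pb)))

module Saturation {X : Set} (_≟_ : DecidableEquality X) (U : List X)
                  (D : List X → X → Set) (D? : ∀ R → Decidable (D R))
                  (P : X → Set) (D-sound : ∀ {R x} → x ∈ U → All P R → D R x → P x) where

  Closed : List X → Set
  Closed R = ∀ {x} → x ∈ U → D R x → x ∈ R

  private
    remove : X → List X → List X
    remove x = filter (¬? ∘ (_≟ x))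

    length-remove : ∀ {x xs} → x ∈ xs → length (remove x xs) < length xs
    length-remove {x} {xs} x∈ =
      filter-notAll (¬? ∘ (_≟ x)) xs (Any.map (λ y≡x ¬y≡x → ¬y≡x (sym y≡x)) x∈)

    grow : (n : ℕ) (R pending : List X) → length pending ≤ n → All P R →
           (∀ {x} → x ∈ pending → x ∈ U) → (∀ {x} → x ∈ U → x ∈ R ⊎ x ∈ pending) →
           Σ[ R ∈ List X ] All P R × Closed R
    grow n R pending len pR pending⊆U U⊆ with any? (D? R) pending
    ... | no none =
      R , pR , λ x∈U d → [ id , (λ x∈ → contradiction (lose x∈ d) none) ]′ (U⊆ x∈U)
    ... | yes some with x , x∈ , d ← find some with n
    ...   | zero  = contradiction (<-≤-trans (length-remove x∈) len) λ ()
    ...   | suc n = grow n (x ∷ R) (remove x pending)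
                      (≤-pred (<-≤-trans (length-remove x∈) len))
                      (D-sound (pending⊆U x∈) pR d ∷ pR)
                      (pending⊆U ∘ proj₁ ∘ ∈-filter⁻ (¬? ∘ (_≟ x)))
                      U⊆′
      where
      U⊆′ : ∀ {y} → y ∈ U → y ∈ x ∷ R ⊎ y ∈ remove x pending
      U⊆′ {y} y∈U with U⊆ y∈U | y ≟ x
      ... | inj₁ y∈R | _     = inj₁ (there y∈R)
      ... | inj₂ _   | yes e = inj₁ (here e)
      ... | inj₂ y∈  | no ne = inj₂ (∈-filter⁺ (¬? ∘ (_≟ x)) y∈ ne)

  saturate : Σ[ R ∈ List X ] All P R × Closed R
  saturate = grow (length U) [] U ≤-refl [] id inj₂

module GroundTerms (Sig : RankedAlphabet) where

  G : Set
  G = GT Sig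

  mutual
    _≟_ : DecidableEquality G
    node f ts ≟ node g us with f Fin.≟ g
    ... | no f≢g = no λ { refl → f≢g refl }
    ... | yes refl with ts ≟* us
    ...   | yes refl = yes refl
    ...   | no ts≢us = no λ { refl → ts≢us refl }

    _≟*_ : ∀ {k} → DecidableEquality (Vec G k)
    []       ≟* []       = yes refl
    (t ∷ ts) ≟* (u ∷ us) with t ≟ u | ts ≟* us
    ... | yes refl | yes refl = yes refl
    ... | no t≢u   | _        = no λ { refl → t≢u refl }
    ... | _        | no ts≢us = no λ { refl → ts≢us refl }

  _≟ₑ_ : DecidableEquality (GEq Sig)
  _≟ₑ_ = ≡-dec _≟_ _≟_

  open DecMembership _≟_ public using (_∈?_)
  open DecMembership _≟ₑ_ public using () renaming (_∈?_ to _∈ₑ?_)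

  mutual
    subterms : G → List G
    subterms (node f ts) = node f ts ∷ subterms* ts

    subterms* : ∀ {k} → Vec G k → List G
    subterms* []       = []
    subterms* (t ∷ ts) = subterms t ++ subterms* ts

  mutual
    ⊑⇒∈-subterms : ∀ {s t} → s ⊑ t → s ∈ subterms t
    ⊑⇒∈-subterms {t = node f ts} self = here refl
    ⊑⇒∈-subterms (sub s⊑ts)         = there (⊑*⇒∈-subterms* s⊑ts)

    ⊑*⇒∈-subterms* : ∀ {s k} {ts : Vec G k} → VAny.Any (s ⊑_) ts → s ∈ subterms* ts
    ⊑*⇒∈-subterms* (here s⊑t)             = ∈-++⁺ˡ (⊑⇒∈-subterms s⊑t)
    ⊑*⇒∈-subterms* {ts = t ∷ _} (there s⊑ts) = ∈-++⁺ʳ (subterms t) (⊑*⇒∈-subterms* s⊑ts)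

  mutual
    ∈-subterms⇒⊑ : ∀ {s} t → s ∈ subterms t → s ⊑ t
    ∈-subterms⇒⊑ (node f ts) (here refl) = self
    ∈-subterms⇒⊑ (node f ts) (there s∈)  = sub (∈-subterms*⇒⊑* ts s∈)

    ∈-subterms*⇒⊑* : ∀ {s k} (ts : Vec G k) → s ∈ subterms* ts → VAny.Any (s ⊑_) ts
    ∈-subterms*⇒⊑* (t ∷ ts) s∈ with ∈-++⁻ (subterms t) s∈
    ... | inj₁ s∈t  = here (∈-subterms⇒⊑ t s∈t)
    ... | inj₂ s∈ts = there (∈-subterms*⇒⊑* ts s∈ts)

  _⊑?_ : ∀ s t → Dec (s ⊑ t)
  s ⊑? t with s ∈? subterms t
  ... | yes s∈ = yes (∈-subterms⇒⊑ t s∈)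
  ... | no s∉  = no (s∉ ∘ ⊑⇒∈-subterms)

  mutual
    ⊑-trans : ∀ {s t u} → s ⊑ t → t ⊑ u → s ⊑ u
    ⊑-trans s⊑t self      = s⊑t
    ⊑-trans s⊑t (sub t⊑u) = sub (⊑-trans* s⊑t t⊑u)

    ⊑-trans* : ∀ {s t k} {us : Vec G k} → s ⊑ t → VAny.Any (t ⊑_) us → VAny.Any (s ⊑_) us
    ⊑-trans* s⊑t (here t⊑u)   = here (⊑-trans s⊑t t⊑u)
    ⊑-trans* s⊑t (there t⊑us) = there (⊑-trans* s⊑t t⊑us)

  ⊑-arg : ∀ {s} {f : Fin (size Sig)} {ts : Vec G (rank Sig f)} →
          s VecMembership.∈ ts → s ⊑ node f ts
  ⊑-arg s∈ts = sub (VAny.map (λ { refl → self }) s∈ts)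

  sides : GEq Sig → List G
  sides (l , r) = subterms l ++ subterms r

  states : GTES Sig → G → G → List G
  states E p q = subterms p ++ subterms q ++ concatMap sides E

  ∈-states⁺ : ∀ {E p q t} → InT E p q t → t ∈ states E p q
  ∈-states⁺ (inj₁ t⊑p) = ∈-++⁺ˡ (⊑⇒∈-subterms t⊑p)
  ∈-states⁺ {p = p} (inj₂ (inj₁ t⊑q)) =
    ∈-++⁺ʳ (subterms p) (∈-++⁺ˡ (⊑⇒∈-subterms t⊑q))
  ∈-states⁺ {p = p} {q} (inj₂ (inj₂ ((l , r) , e∈ , t⊑e))) =
    ∈-++⁺ʳ (subterms p) (∈-++⁺ʳ (subterms q) (∈-concatMap⁺ sides (lose e∈ (in-sides t⊑e))))
    where
    in-sides : _ → _ ∈ sides (l , r)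
    in-sides (inj₁ t⊑l) = ∈-++⁺ˡ (⊑⇒∈-subterms t⊑l)
    in-sides (inj₂ t⊑r) = ∈-++⁺ʳ (subterms l) (⊑⇒∈-subterms t⊑r)

  ∈-states⁻ : ∀ {E p q t} → t ∈ states E p q → InT E p q t
  ∈-states⁻ {E} {p} {q} t∈ with ∈-++⁻ (subterms p) t∈
  ... | inj₁ t∈p = inj₁ (∈-subterms⇒⊑ p t∈p)
  ... | inj₂ t∈′ with ∈-++⁻ (subterms q) t∈′
  ...   | inj₁ t∈q = inj₂ (inj₁ (∈-subterms⇒⊑ q t∈q))
  ...   | inj₂ t∈E with (l , r) , e∈ , t∈lr ← find (∈-concatMap⁻ sides {xs = E} t∈E)
                   with ∈-++⁻ (subterms l) t∈lr
  ...     | inj₁ t∈l = inj₂ (inj₂ (_ , e∈ , inj₁ (∈-subterms⇒⊑ l t∈l)))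
  ...     | inj₂ t∈r = inj₂ (inj₂ (_ , e∈ , inj₂ (∈-subterms⇒⊑ r t∈r)))

  InT-⊑ : ∀ {E p q s t} → InT E p q t → s ⊑ t → InT E p q s
  InT-⊑ (inj₁ t⊑p) s⊑t = inj₁ (⊑-trans s⊑t t⊑p)
  InT-⊑ (inj₂ (inj₁ t⊑q)) s⊑t = inj₂ (inj₁ (⊑-trans s⊑t t⊑q))
  InT-⊑ (inj₂ (inj₂ (e , e∈ , t⊑e))) s⊑t =
    inj₂ (inj₂ (e , e∈ , Sum.map (⊑-trans s⊑t) (⊑-trans s⊑t) t⊑e))

  states-⊑-closed : ∀ {E p q s t} → t ∈ states E p q → s ⊑ t → s ∈ states E p q
  states-⊑-closed {E} {p} {q} t∈ s⊑t = ∈-states⁺ (InT-⊑ (∈-states⁻ {E} {p} {q} t∈) s⊑t)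

  E-sides∈states : ∀ {E p q l r} → (l , r) ∈ E → l ∈ states E p q × r ∈ states E p q
  E-sides∈states {E} {p} {q} e∈ =
    ∈-states⁺ {E} {p} {q} (inj₂ (inj₂ (_ , e∈ , inj₁ self))) ,
    ∈-states⁺ {E} {p} {q} (inj₂ (inj₂ (_ , e∈ , inj₂ self)))

  InT? : ∀ E p q t → Dec (InT E p q t)
  InT? E p q t with t ∈? states E p q
  ... | yes t∈ = yes (∈-states⁻ t∈)
  ... | no t∉  = no (t∉ ∘ ∈-states⁺)

  embed* : ∀ {L k} → Vec G k → Vec (Tm Sig L) k
  embed* ts = ts ⟪ (λ ()) ⟫*

  mutual
    embed-⟪⟫ : ∀ {L M : Set} (t : G) (σ : L → Tm Sig M) → embed {M = L} t ⟪ σ ⟫ ≡ embed t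
    embed-⟪⟫ (node f ts) σ = cong (node f) (embed*-⟪⟫* ts σ)

    embed*-⟪⟫* : ∀ {L M : Set} {k} (ts : Vec G k) (σ : L → Tm Sig M) →
                 embed* {L} ts ⟪ σ ⟫* ≡ embed* ts
    embed*-⟪⟫* []       σ = refl
    embed*-⟪⟫* (t ∷ ts) σ = cong₂ _∷_ (embed-⟪⟫ t σ) (embed*-⟪⟫* ts σ)

  mutual
    embed-ground : (t : G) → embed t ≡ t
    embed-ground (node f ts) = cong (node f) (embed*-ground ts)

    embed*-ground : ∀ {k} (ts : Vec G k) → embed* ts ≡ ts
    embed*-ground []       = refl
    embed*-ground (t ∷ ts) = cong₂ _∷_ (embed-ground t) (embed*-ground ts)

  mutual
    leaves-embed : ∀ {L : Set} (t : G) → leaves (embed {M = L} t) ≡ 0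
    leaves-embed (node f ts) = leaves*-embed* ts

    leaves*-embed* : ∀ {L : Set} {k} (ts : Vec G k) → leaves* (embed* {L} ts) ≡ 0
    leaves*-embed* []           = refl
    leaves*-embed* {L} (t ∷ ts) = cong₂ _+_ (leaves-embed {L} t) (leaves*-embed* {L} ts)

  leaves*-≔ : ∀ {L k} (ts : Vec G k) i (u : Tm Sig L) → leaves* (embed* ts [ i ]≔ u) ≡ leaves u
  leaves*-≔ {L} (t ∷ ts) zero    u =
    trans (cong (leaves u +_) (leaves*-embed* {L} ts)) (+-identityʳ _)
  leaves*-≔ {L} (t ∷ ts) (suc i) u =
    trans (cong (_+ leaves* (embed* ts [ i ]≔ u)) (leaves-embed {L} t)) (leaves*-≔ ts i u)

  ⟪⟫*-≔ : ∀ {L M k} (ts : Vec G k) i (u : Tm Sig L) (σ : L → Tm Sig M) →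
          (embed* ts [ i ]≔ u) ⟪ σ ⟫* ≡ embed* ts [ i ]≔ (u ⟪ σ ⟫)
  ⟪⟫*-≔ (t ∷ ts) zero    u σ = cong (u ⟪ σ ⟫ ∷_) (embed*-⟪⟫* ts σ)
  ⟪⟫*-≔ (t ∷ ts) (suc i) u σ = cong₂ _∷_ (embed-⟪⟫ t σ) (⟪⟫*-≔ ts i u σ)

  argContext : ∀ f → Vec G (rank Sig f) → Fin (rank Sig f) → Context {Sig} → Context {Sig}
  argContext f ts i (u , one-hole) = node f (embed* ts [ i ]≔ u) , trans (leaves*-≔ ts i u) one-hole

  plug-argContext : ∀ {M : Set} f ts i (c : Context {Sig}) (s : Tm Sig M) →
                    plug (argContext f ts i c) s ≡ node f (embed* ts [ i ]≔ plug c s)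
  plug-argContext f ts i (u , _) s = cong (node f) (⟪⟫*-≔ ts i u (λ _ → s))

  plug-argContext-ground : ∀ f ts i (c : Context {Sig}) (s : G) →
                           plug (argContext f ts i c) s ≡ node f (ts [ i ]≔ plug c s)
  plug-argContext-ground f ts i c s =
    trans (plug-argContext f ts i c s) (cong (λ vs → node f (vs [ i ]≔ plug c s)) (embed*-ground ts))

  Step-arg : ∀ {E : GTES Sig} f ts i {a b} →
             Step E a b → Step E (node f (ts [ i ]≔ a)) (node f (ts [ i ]≔ b))
  Step-arg f ts i (c , e , e∈ , inj₁ (refl , refl)) =
    argContext f ts i c , e , e∈ ,
    inj₁ (sym (plug-argContext-ground f ts i c _) , sym (plug-argContext-ground f ts i c _))
  Step-arg f ts i (c , e , e∈ , inj₂ (refl , refl)) =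
    argContext f ts i c , e , e∈ ,
    inj₂ (sym (plug-argContext-ground f ts i c _) , sym (plug-argContext-ground f ts i c _))

  Step-sym : ∀ {E : GTES Sig} {a b} → Step E a b → Step E b a
  Step-sym (c , e , e∈ , inj₁ (a≡ , b≡)) = c , e , e∈ , inj₂ (b≡ , a≡)
  Step-sym (c , e , e∈ , inj₂ (a≡ , b≡)) = c , e , e∈ , inj₁ (b≡ , a≡)

  Conv-sym : ∀ {E : GTES Sig} {a b} → Conv E a b → Conv E b a
  Conv-sym = reverse Step-sym

  Conv-axiom : ∀ {E : GTES Sig} {l r} → (l , r) ∈ E → Conv E l r
  Conv-axiom e∈ = ((leaf zero , refl) , _ , e∈ , inj₁ (refl , refl)) ◅ ε

  -- The congruence is proved for an arbitrary H : Vec G k → G so that the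
  -- induction can peel off the first argument.
  Conv-args : ∀ {E : GTES Sig} {k} (H : Vec G k → G) →
              (∀ ts i {a b} → Step E a b → Step E (H (ts [ i ]≔ a)) (H (ts [ i ]≔ b))) →
              ∀ {ss ts} → Pointwise (Conv E) ss ts → Conv E (H ss) (H ts)
  Conv-args H H-step [] = ε
  Conv-args H H-step (_∷_ {x = s} {y = t} {xs = ss} s⇔t ss⇔ts) =
    gmap (λ a → H (a ∷ ss)) (H-step (s ∷ ss) zero) s⇔t ◅◅
    Conv-args (λ us → H (t ∷ us)) (λ us i → H-step (t ∷ us) (suc i)) ss⇔ts

  Conv-cong : ∀ {E : GTES Sig} f {ss ts} → Pointwise (Conv E) ss ts → Conv E (node f ss) (node f ts)
  Conv-cong f = Conv-args (node f) (Step-arg f)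

module CongruenceClosure (Sig : RankedAlphabet) (E : GTES Sig) (T : List (GT Sig))
    (T-⊑-closed : ∀ {s t} → t ∈ T → s ⊑ t → s ∈ T)
    (E-sides∈T : ∀ {l r} → (l , r) ∈ E → l ∈ T × r ∈ T) where

  open GroundTerms Sig

  args∈T : ∀ {f us} → node f us ∈ T → VAll.All (_∈ T) us
  args∈T {us = us} u∈ = lookup⁻ λ i → T-⊑-closed u∈ (⊑-arg (∈-lookup i us))

  data ArgsIn (R : List (GEq Sig)) : G → G → Set where
    args : ∀ {f ss ts} → Pointwise (λ s t → (s , t) ∈ R) ss ts → ArgsIn R (node f ss) (node f ts)

  ArgsIn? : ∀ R s t → Dec (ArgsIn R s t)
  ArgsIn? R (node f ss) (node g ts) with f Fin.≟ g
  ... | no f≢g = no λ { (args _) → f≢g refl }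
  ... | yes refl with Pointwise.decidable (λ s t → (s , t) ∈ₑ? R) ss ts
  ...   | yes ss∼ts = yes (args ss∼ts)
  ...   | no ¬ss∼ts = no λ { (args ss∼ts) → ¬ss∼ts ss∼ts }

  ClosureStep : List (GEq Sig) → GEq Sig → Set
  ClosureStep R (s , t) = (s , t) ∈ E ⊎ s ≡ t ⊎ (t , s) ∈ R ⊎
                          Any (λ u → (s , u) ∈ R × (u , t) ∈ R) T ⊎ ArgsIn R s t

  ClosureStep? : ∀ R → Decidable (ClosureStep R)
  ClosureStep? R (s , t) =
    (s , t) ∈ₑ? E ⊎-dec s ≟ t ⊎-dec (t , s) ∈ₑ? R ⊎-dec
    any? (λ u → ((s , u) ∈ₑ? R) ×-dec ((u , t) ∈ₑ? R)) T ⊎-dec ArgsIn? R s t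

  Sound : GEq Sig → Set
  Sound (s , t) = Conv E s t × s ∈ T × t ∈ T

  ClosureStep-sound : ∀ {R e} → e ∈ cartesianProduct T T → All Sound R → ClosureStep R e → Sound e
  ClosureStep-sound {R} {s , t} e∈ sound step = conv step , ∈-cartesianProduct⁻ T T e∈
    where
    conv : ClosureStep R (s , t) → Conv E s t
    conv (inj₁ e∈E) = Conv-axiom e∈E
    conv (inj₂ (inj₁ refl)) = ε
    conv (inj₂ (inj₂ (inj₁ ts∈))) = Conv-sym (proj₁ (All.lookup sound ts∈))
    conv (inj₂ (inj₂ (inj₂ (inj₁ via))))
      with _ , _ , su∈ , ut∈ ← find via =
      proj₁ (All.lookup sound su∈) ◅◅ proj₁ (All.lookup sound ut∈)
    conv (inj₂ (inj₂ (inj₂ (inj₂ (args {f} ss∼ts))))) =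
      Conv-cong f (Pointwise.map (proj₁ ∘ All.lookup sound) ss∼ts)

  open Saturation _≟ₑ_ (cartesianProduct T T) ClosureStep ClosureStep? Sound ClosureStep-sound

  Θ : List (GEq Sig)
  Θ = proj₁ saturate

  Θ-closed : ∀ {s t} → s ∈ T → t ∈ T → ClosureStep Θ (s , t) → (s , t) ∈ Θ
  Θ-closed s∈ t∈ = proj₂ (proj₂ saturate) (∈-cartesianProduct⁺ s∈ t∈)

  Θ-sound : ∀ {s t} → (s , t) ∈ Θ → Sound (s , t)
  Θ-sound = All.lookup (proj₁ (proj₂ saturate))

  Θ-refl : ∀ {s} → s ∈ T → (s , s) ∈ Θ
  Θ-refl s∈ = Θ-closed s∈ s∈ (inj₂ (inj₁ refl))

  Θ-sym : ∀ {s t} → (s , t) ∈ Θ → (t , s) ∈ Θ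
  Θ-sym st∈ with _ , s∈ , t∈ ← Θ-sound st∈ = Θ-closed t∈ s∈ (inj₂ (inj₂ (inj₁ st∈)))

  Θ-trans : ∀ {s u t} → (s , u) ∈ Θ → (u , t) ∈ Θ → (s , t) ∈ Θ
  Θ-trans su∈ ut∈ with _ , s∈ , u∈ ← Θ-sound su∈ | _ , _ , t∈ ← Θ-sound ut∈ =
    Θ-closed s∈ t∈ (inj₂ (inj₂ (inj₂ (inj₁ (lose u∈ (su∈ , ut∈))))))

  Θ-axiom : ∀ {l r} → (l , r) ∈ E → (l , r) ∈ Θ
  Θ-axiom e∈ = Θ-closed (proj₁ (E-sides∈T e∈)) (proj₂ (E-sides∈T e∈)) (inj₁ e∈)

  firstRelated : List G → G → G
  firstRelated []       u = u
  firstRelated (w ∷ ws) u with (w , u) ∈ₑ? Θ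
  ... | yes _ = w
  ... | no _  = firstRelated ws u

  firstRelated-Θ : ∀ {u} ws → Any (λ w → (w , u) ∈ Θ) ws → (firstRelated ws u , u) ∈ Θ
  firstRelated-Θ {u} (w ∷ ws) some with (w , u) ∈ₑ? Θ
  ... | yes wu∈ = wu∈
  firstRelated-Θ (w ∷ ws) (here wu∈)   | no wu∉ = contradiction wu∈ wu∉
  firstRelated-Θ (w ∷ ws) (there some) | no _   = firstRelated-Θ ws some

  firstRelated-cong : ∀ {u v} ws → (∀ {w} → (w , u) ∈ Θ → (w , v) ∈ Θ) →
                      (∀ {w} → (w , v) ∈ Θ → (w , u) ∈ Θ) →
                      Any (λ w → (w , u) ∈ Θ) ws → firstRelated ws u ≡ firstRelated ws v
  firstRelated-cong {u} {v} (w ∷ ws) u⇒v v⇒u some with (w , u) ∈ₑ? Θ | (w , v) ∈ₑ? Θ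
  ... | yes _   | yes _   = refl
  ... | yes wu∈ | no wv∉  = contradiction (u⇒v wu∈) wv∉
  ... | no wu∉  | yes wv∈ = contradiction (v⇒u wv∈) wu∉
  firstRelated-cong (w ∷ ws) u⇒v v⇒u (here wu∈)   | no wu∉ | no _ = contradiction wu∈ wu∉
  firstRelated-cong (w ∷ ws) u⇒v v⇒u (there some) | no _   | no _ = firstRelated-cong ws u⇒v v⇒u some

  representative : G → G
  representative = firstRelated T

  representative-Θ : ∀ {u} → u ∈ T → (representative u , u) ∈ Θ
  representative-Θ u∈ = firstRelated-Θ T (lose u∈ (Θ-refl u∈))

  representative-cong : ∀ {u v} → u ∈ T → (u , v) ∈ Θ → representative u ≡ representative v
  representative-cong u∈ uv∈ =
    firstRelated-cong T (λ wu∈ → Θ-trans wu∈ uv∈) (λ wv∈ → Θ-trans wv∈ (Θ-sym uv∈))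
      (lose u∈ (Θ-refl u∈))

  representative-Θ⁻ : ∀ {u v} → u ∈ T → v ∈ T →
                      representative u ≡ representative v → (u , v) ∈ Θ
  representative-Θ⁻ {v = v} u∈ v∈ ru≡rv =
    Θ-trans (Θ-sym (representative-Θ u∈))
            (subst (λ w → (w , v) ∈ Θ) (sym ru≡rv) (representative-Θ v∈))

  HasRepresentatives : ∀ {k} → Vec G k → Vec G k → Set
  HasRepresentatives = Pointwise (λ u n → representative u ≡ n)

  HasRepresentatives⇒Θ : ∀ {k} {us vs ns : Vec G k} → VAll.All (_∈ T) us → VAll.All (_∈ T) vs →
                         HasRepresentatives us ns → HasRepresentatives vs ns →
                         Pointwise (λ u v → (u , v) ∈ Θ) us vs
  HasRepresentatives⇒Θ [] [] [] [] = []
  HasRepresentatives⇒Θ (u∈ ∷ us∈) (v∈ ∷ vs∈) (ru ∷ rus) (rv ∷ rvs) =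
    representative-Θ⁻ u∈ v∈ (trans ru (sym rv)) ∷ HasRepresentatives⇒Θ us∈ vs∈ rus rvs

  HasRepresentatives⇒Conv : ∀ {k} {us ns : Vec G k} → VAll.All (_∈ T) us →
                            HasRepresentatives us ns → Pointwise (Conv E) ns us
  HasRepresentatives⇒Conv [] [] = []
  HasRepresentatives⇒Conv (u∈ ∷ us∈) (refl ∷ rus) =
    proj₁ (Θ-sound (representative-Θ u∈)) ∷ HasRepresentatives⇒Conv us∈ rus

  data Matches (f : Fin (size Sig)) (ns : Vec G (rank Sig f)) : G → Set where
    matches : ∀ {us} → HasRepresentatives us ns → Matches f ns (node f us)

  Matches? : ∀ f ns → Decidable (Matches f ns)
  Matches? f ns (node g us) with g Fin.≟ f
  ... | no g≢f = no λ { (matches _) → g≢f refl }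
  ... | yes refl with Pointwise.decidable (λ u n → representative u ≟ n) us ns
  ...   | yes rus = yes (matches rus)
  ...   | no ¬rus = no λ { (matches rus) → ¬rus rus }

  firstMatch : ∀ f → Vec G (rank Sig f) → List G → G
  firstMatch f ns []       = node f ns
  firstMatch f ns (u ∷ us) with Matches? f ns u
  ... | yes _ = representative u
  ... | no _  = firstMatch f ns us

  firstMatch-spec : ∀ f ns ws →
                    (∃[ u ] u ∈ ws × Matches f ns u × firstMatch f ns ws ≡ representative u) ⊎
                    (¬ Any (Matches f ns) ws × firstMatch f ns ws ≡ node f ns)
  firstMatch-spec f ns [] = inj₂ ((λ ()) , refl)
  firstMatch-spec f ns (u ∷ us) with Matches? f ns u
  ... | yes m = inj₁ (u , here refl , m , refl)
  ... | no ¬m with firstMatch-spec f ns us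
  ...   | inj₁ (w , w∈ , m , eq) = inj₁ (w , there w∈ , m , eq)
  ...   | inj₂ (none , eq)      = inj₂ ((λ { (here m) → ¬m m ; (there ms) → none ms }) , eq)

  -- A node congruent to no term of T forms its own class up to the classes of
  -- its arguments, so it may be left in place.
  mutual
    nf : G → G
    nf (node f ts) = firstMatch f (nf* ts) T

    nf* : ∀ {k} → Vec G k → Vec G k
    nf* []       = []
    nf* (t ∷ ts) = nf t ∷ nf* ts

  mutual
    nf-representative : ∀ {u} → u ∈ T → nf u ≡ representative u
    nf-representative {node f us} u∈ with firstMatch-spec f (nf* us) T
    ... | inj₂ (none , _) = contradiction (lose u∈ (matches (nf*-representatives (args∈T u∈)))) none
    ... | inj₁ (node _ vs , v∈ , matches rvs , eq) =
      trans eq (representative-cong v∈ (Θ-closed v∈ u∈ (inj₂ (inj₂ (inj₂ (inj₂ (args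
        (HasRepresentatives⇒Θ (args∈T v∈) (args∈T u∈) rvs
                              (nf*-representatives (args∈T u∈))))))))))

    nf*-representatives : ∀ {k} {us : Vec G k} → VAll.All (_∈ T) us → HasRepresentatives us (nf* us)
    nf*-representatives []         = []
    nf*-representatives (u∈ ∷ us∈) = sym (nf-representative u∈) ∷ nf*-representatives us∈

  mutual
    nf-⟪⟫ : ∀ (u : Tm Sig (Fin 1)) {a b} → nf a ≡ nf b →
            nf (u ⟪ (λ _ → a) ⟫) ≡ nf (u ⟪ (λ _ → b) ⟫)
    nf-⟪⟫ (leaf zero)  a≡b = a≡b
    nf-⟪⟫ (node f us) a≡b = cong (λ ns → firstMatch f ns T) (nf*-⟪⟫* us a≡b)

    nf*-⟪⟫* : ∀ {k} (us : Vec (Tm Sig (Fin 1)) k) {a b} → nf a ≡ nf b →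
              nf* (us ⟪ (λ _ → a) ⟫*) ≡ nf* (us ⟪ (λ _ → b) ⟫*)
    nf*-⟪⟫* []       a≡b = refl
    nf*-⟪⟫* (u ∷ us) a≡b = cong₂ _∷_ (nf-⟪⟫ u a≡b) (nf*-⟪⟫* us a≡b)

  nf-axiom : ∀ {l r} → (l , r) ∈ E → nf l ≡ nf r
  nf-axiom {l} {r} e∈ with l∈ , r∈ ← E-sides∈T e∈ = begin
    nf l             ≡⟨ nf-representative l∈ ⟩
    representative l ≡⟨ representative-cong l∈ (Θ-axiom e∈) ⟩
    representative r ≡⟨ nf-representative r∈ ⟨
    nf r             ∎
    where open ≡-Reasoning

  nf-Step : ∀ {s t} → Step E s t → nf s ≡ nf t
  nf-Step ((u , _) , _ , e∈ , inj₁ (refl , refl)) = nf-⟪⟫ u (nf-axiom e∈)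
  nf-Step ((u , _) , _ , e∈ , inj₂ (refl , refl)) = nf-⟪⟫ u (sym (nf-axiom e∈))

  Conv⇒nf≡ : ∀ {s t} → Conv E s t → nf s ≡ nf t
  Conv⇒nf≡ ε            = refl
  Conv⇒nf≡ (step ◅ s⇔t) = trans (nf-Step step) (Conv⇒nf≡ s⇔t)

  mutual
    Conv-nf : ∀ s → Conv E s (nf s)
    Conv-nf (node f ts) with firstMatch-spec f (nf* ts) T
    ... | inj₂ (_ , eq) = subst (Conv E (node f ts)) (sym eq) (Conv-cong f (Conv*-nf* ts))
    ... | inj₁ (node _ us , u∈ , matches rus , eq) = subst (Conv E (node f ts)) (sym eq)
      (Conv-cong f (Conv*-nf* ts) ◅◅ Conv-cong f (HasRepresentatives⇒Conv (args∈T u∈) rus)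
        ◅◅ Conv-sym (proj₁ (Θ-sound (representative-Θ u∈))))

    Conv*-nf* : ∀ {k} (ts : Vec G k) → Pointwise (Conv E) ts (nf* ts)
    Conv*-nf* []       = []
    Conv*-nf* (t ∷ ts) = Conv-nf t ∷ Conv*-nf* ts

  Conv? : ∀ s t → Dec (Conv E s t)
  Conv? s t with nf s ≟ nf t
  ... | yes eq = yes (Conv-nf s ◅◅ subst (λ n → Conv E n t) (sym eq) (Conv-sym (Conv-nf t)))
  ... | no neq = no (neq ∘ Conv⇒nf≡)

module Automaton (Sig : RankedAlphabet) (E : GTES Sig) (p q : GT Sig) where

  open GroundTerms Sig
  open CongruenceClosure Sig E (states E p q) (states-⊑-closed {E} {p} {q}) (E-sides∈states {E} {p} {q})
    using (Conv?) public

  data Transition (f : Fin (size Sig)) (us : Vec (Tm Sig G) (rank Sig f)) (t : G) : G → Set where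
    transition : ∀ {ts} → Pointwise (Reach E p q) us ts → InT E p q t → Conv E (node f ts) t →
                 Transition f us t (node f ts)

  mutual
    Reach? : ∀ u t → Dec (Reach E p q u t)
    Reach? (leaf s) t with InT? E p q s ×-dec InT? E p q t ×-dec Conv? s t
    ... | yes (s∈ , t∈ , s⇔t) = yes (st s∈ t∈ s⇔t)
    ... | no ¬reach = no λ { (st s∈ t∈ s⇔t) → ¬reach (s∈ , t∈ , s⇔t) }
    Reach? (node f us) t with any? (Transition? f us t) (states E p q)
    ... | no none = no λ { (nd ts us→ts w∈ t∈ w⇔t) →
                             none (lose (∈-states⁺ w∈) (transition us→ts t∈ w⇔t)) }
    ... | yes some with find some
    ...   | _ , w∈ , transition {ts} us→ts t∈ w⇔t = yes (nd ts us→ts (∈-states⁻ w∈) t∈ w⇔t)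

    Transition? : ∀ f us t → Decidable (Transition f us t)
    Transition? f us t (node g ts) with g Fin.≟ f
    ... | no g≢f = no λ { (transition _ _ _) → g≢f refl }
    ... | yes refl with Reach*? us ts ×-dec InT? E p q t ×-dec Conv? (node f ts) t
    ...   | yes (us→ts , t∈ , w⇔t) = yes (transition us→ts t∈ w⇔t)
    ...   | no ¬tr = no λ { (transition us→ts t∈ w⇔t) → ¬tr (us→ts , t∈ , w⇔t) }

    Reach*? : ∀ {k} (us : Vec (Tm Sig G) k) (ts : Vec G k) → Dec (Pointwise (Reach E p q) us ts)
    Reach*? []       []       = yes []
    Reach*? (u ∷ us) (t ∷ ts) with Reach? u t ×-dec Reach*? us ts
    ... | yes (u→t , us→ts) = yes (u→t ∷ us→ts)
    ... | no ¬reach = no λ { (u→t ∷ us→ts) → ¬reach (u→t , us→ts) }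

  mutual
    Reach-embed : ∀ {s} → InT E p q s → Reach E p q (embed s) s
    Reach-embed {node f ss} s∈ = nd ss (Reach*-embed* (InT-⊑ s∈ ∘ sub)) s∈ s∈ ε

    Reach*-embed* : ∀ {k} {ss : Vec G k} → (∀ {x} → VAny.Any (x ⊑_) ss → InT E p q x) →
                    Pointwise (Reach E p q) (embed* ss) ss
    Reach*-embed* {ss = []}     _   = []
    Reach*-embed* {ss = s ∷ ss} ss∈ = Reach-embed (ss∈ (here self)) ∷ Reach*-embed* (ss∈ ∘ there)

  module From (c : G) where

    data Feeds (Q : List G) (t : G) : G → Set where
      feeds : ∀ {f ts} → VAny.Any (_∈ Q) ts → Conv E (node f ts) t → Feeds Q t (node f ts)

    Feeds? : ∀ Q t → Decidable (Feeds Q t)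
    Feeds? Q t (node f ts) with VAny.any? (_∈? Q) ts ×-dec Conv? (node f ts) t
    ... | yes (some , w⇔t) = yes (feeds some w⇔t)
    ... | no ¬feeds = no λ { (feeds some w⇔t) → ¬feeds (some , w⇔t) }

    ReachedIn : List G → G → Set
    ReachedIn Q t = (InT E p q c × Conv E c t) ⊎ Any (Feeds Q t) (states E p q)

    ReachedIn? : ∀ Q → Decidable (ReachedIn Q)
    ReachedIn? Q t = (InT? E p q c ×-dec Conv? c t) ⊎-dec any? (Feeds? Q t) (states E p q)

    Reached : G → Set
    Reached = ReachesFrom E p q c

    Reach*-hole : ∀ {k} {ts : Vec G k} → (∀ {x} → VAny.Any (x ⊑_) ts → InT E p q x) →
                  VAny.Any Reached ts →
                  ∃[ i ] ∃[ u ] Pointwise (Reach E p q) (embed* ts [ i ]≔ plug u (leaf c)) ts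
    Reach*-hole {ts = t ∷ ts} ts∈ (here (u , u→t)) = zero , u , u→t ∷ Reach*-embed* (ts∈ ∘ there)
    Reach*-hole {ts = t ∷ ts} ts∈ (there some) with i , u , us→ts ← Reach*-hole (ts∈ ∘ there) some =
      suc i , u , Reach-embed (ts∈ (here self)) ∷ us→ts

    ReachedIn-sound : ∀ {Q t} → t ∈ states E p q → All Reached Q → ReachedIn Q t → Reached t
    ReachedIn-sound t∈ _ (inj₁ (c∈ , c⇔t)) = (leaf zero , refl) , st c∈ (∈-states⁻ t∈) c⇔t
    ReachedIn-sound {Q} {t} t∈ reached (inj₂ some)
      with node f ts , w∈ , feeds inQ w⇔t ← find some
      with i , u , args→ts ←
             Reach*-hole (InT-⊑ (∈-states⁻ w∈) ∘ sub) (VAny.map (All.lookup reached) inQ) =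
      argContext f ts i u ,
      subst (λ v → Reach E p q v t) (sym (plug-argContext f ts i u (leaf c)))
        (nd ts args→ts (∈-states⁻ w∈) (∈-states⁻ t∈) w⇔t)

    open Saturation _≟_ (states E p q) ReachedIn ReachedIn? Reached ReachedIn-sound

    reached : List G
    reached = proj₁ saturate

    reached-closed : ∀ {t} → InT E p q t → ReachedIn reached t → t ∈ reached
    reached-closed t∈ = proj₂ (proj₂ saturate) (∈-states⁺ t∈)

    mutual
      Reach-plug⇒∈reached : ∀ (u : Tm Sig (Fin 1)) {b} → leaves u ≡ 1 →
                            Reach E p q (u ⟪ (λ _ → leaf c) ⟫) b → b ∈ reached
      Reach-plug⇒∈reached (leaf zero) _ (st c∈ b∈ c⇔b) = reached-closed b∈ (inj₁ (c∈ , c⇔b))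
      Reach-plug⇒∈reached (node f us) one-hole (nd ts us→ts w∈ b∈ w⇔b) =
        reached-closed b∈
          (inj₂ (lose (∈-states⁺ w∈) (feeds (Reach*-plug⇒∈reached us one-hole us→ts) w⇔b)))

      Reach*-plug⇒∈reached : ∀ {k} (us : Vec (Tm Sig (Fin 1)) k) {ts : Vec G k} → leaves* us ≡ 1 →
                             Pointwise (Reach E p q) (us ⟪ (λ _ → leaf c) ⟫*) ts →
                             VAny.Any (_∈ reached) ts
      Reach*-plug⇒∈reached (u ∷ us) one-hole (u→t ∷ us→ts) with leaves u in holes-u
      ... | zero        = there (Reach*-plug⇒∈reached us one-hole us→ts)
      ... | suc zero    = here (Reach-plug⇒∈reached u holes-u u→t)
      ... | suc (suc _) = contradiction one-hole λ ()

    ReachesFrom? : Decidable (ReachesFrom E p q c)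
    ReachesFrom? b with b ∈? reached
    ... | yes b∈ = yes (All.lookup (proj₁ (proj₂ saturate)) b∈)
    ... | no b∉  = no λ { ((u , one-hole) , u→b) → b∉ (Reach-plug⇒∈reached u one-hole u→b) }

  open From using (ReachesFrom?) public

module Substitution (Sig : RankedAlphabet) where

  open GroundTerms Sig using (G)

  mutual
    Occurs? : ∀ {m} (j : Fin m) (t : Tm Sig (Fin m)) → Dec (Occurs j t)
    Occurs? j (leaf x) with j Fin.≟ x
    ... | yes refl = yes here
    ... | no j≢x   = no λ { here → j≢x refl }
    Occurs? j (node f ts) with Occurs*? j ts
    ... | yes j∈ts = yes (there j∈ts)
    ... | no j∉ts  = no λ { (there j∈ts) → j∉ts j∈ts }

    Occurs*? : ∀ {m k} (j : Fin m) (ts : Vec (Tm Sig (Fin m)) k) → Dec (VAny.Any (Occurs j) ts)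
    Occurs*? j []       = no λ ()
    Occurs*? j (t ∷ ts) with Occurs? j t | Occurs*? j ts
    ... | yes j∈t | _        = yes (here j∈t)
    ... | no _    | yes j∈ts = yes (there j∈ts)
    ... | no j∉t  | no j∉ts  = no λ { (here j∈t) → j∉t j∈t ; (there j∈ts) → j∉ts j∈ts }

  mutual
    ⟪⟫-cong-Occurs : ∀ {L M : Set} (t : Tm Sig L) {σ τ : L → Tm Sig M} →
                     (∀ {j} → Occurs j t → σ j ≡ τ j) → t ⟪ σ ⟫ ≡ t ⟪ τ ⟫
    ⟪⟫-cong-Occurs (leaf x)    σ≗τ = σ≗τ here
    ⟪⟫-cong-Occurs (node f ts) σ≗τ = cong (node f) (⟪⟫*-cong-Occurs ts (σ≗τ ∘ there))

    ⟪⟫*-cong-Occurs : ∀ {L M : Set} {k} (ts : Vec (Tm Sig L) k) {σ τ : L → Tm Sig M} →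
                      (∀ {j} → VAny.Any (Occurs j) ts → σ j ≡ τ j) → ts ⟪ σ ⟫* ≡ ts ⟪ τ ⟫*
    ⟪⟫*-cong-Occurs []       σ≗τ = refl
    ⟪⟫*-cong-Occurs (t ∷ ts) σ≗τ =
      cong₂ _∷_ (⟪⟫-cong-Occurs t (σ≗τ ∘ here)) (⟪⟫*-cong-Occurs ts (σ≗τ ∘ there))

  mutual
    Occurs⇒⊑ : ∀ {L : Set} {x : L} {t : Tm Sig L} (σ : L → G) → Occurs x t → σ x ⊑ (t ⟪ σ ⟫)
    Occurs⇒⊑ σ here         = self
    Occurs⇒⊑ σ (there x∈ts) = sub (Occurs*⇒⊑* σ x∈ts)

    Occurs*⇒⊑* : ∀ {L : Set} {x : L} {k} {ts : Vec (Tm Sig L) k} (σ : L → G) →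
                 VAny.Any (Occurs x) ts → VAny.Any (σ x ⊑_) (ts ⟪ σ ⟫*)
    Occurs*⇒⊑* σ (here x∈t)   = here (Occurs⇒⊑ σ x∈t)
    Occurs*⇒⊑* σ (there x∈ts) = there (Occurs*⇒⊑* σ x∈ts)

module Construction (Sig : RankedAlphabet) (sel : Selector {Sig}) where

  open GroundTerms Sig
  open Substitution Sig

  groundInstance : (eq : Eqn Sig) → Vec G (proj₁ eq) → GEq Sig
  groundInstance eq us = inst (proj₁ (proj₂ eq)) us , inst (proj₂ (proj₂ eq)) us

  module FirstSystem (S : TES Sig) (p q : G) where

    pqSubterms : List G
    pqSubterms = subterms p ++ subterms q

    SubPQ? : Decidable (SubPQ p q)
    SubPQ? t = t ⊑? p ⊎-dec t ⊑? q

    SubPQ-⊑ : ∀ {s t} → SubPQ p q t → s ⊑ t → s ∈ pqSubterms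
    SubPQ-⊑ (inj₁ t⊑p) s⊑t = ∈-++⁺ˡ (⊑⇒∈-subterms (⊑-trans s⊑t t⊑p))
    SubPQ-⊑ (inj₂ t⊑q) s⊑t = ∈-++⁺ʳ (subterms p) (⊑⇒∈-subterms (⊑-trans s⊑t t⊑q))

    Relevant : (eq : Eqn Sig) → Vec G (proj₁ eq) → Set
    Relevant eq us = SubPQ p q (proj₁ (groundInstance eq us)) ⊎ SubPQ p q (proj₂ (groundInstance eq us))

    Relevant? : ∀ eq → Decidable (Relevant eq)
    Relevant? eq us = SubPQ? (proj₁ (groundInstance eq us)) ⊎-dec SubPQ? (proj₂ (groundInstance eq us))

    open Collect (λ eq → vectorsOver pqSubterms (proj₁ eq)) groundInstance Relevant?

    W₁ : GTES Sig
    W₁ = collect S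

    -- Variables occurring in l (equivalently in r) are instantiated by
    -- subterms of p or q; the remaining ones are irrelevant and sent to p.
    restrict-substitution : VarPreserving S → ∀ {eq} → eq ∈ S → ∀ {us} → Relevant eq us →
                            ∃[ us′ ] VAll.All (_∈ pqSubterms) us′ ×
                                     groundInstance eq us ≡ groundInstance eq us′ × Relevant eq us′
    restrict-substitution vp {eq = m , l , r} eq∈ {us} relevant =
      us′ , lookup⁻ restricted∈ , cong₂ _,_ l-same r-same ,
      Sum.map (subst (SubPQ p q) l-same) (subst (SubPQ p q) r-same) relevant
      where
      l⇒r : ∀ {j} → Occurs j l → Occurs j r
      l⇒r = Equivalence.to (vp eq∈ _)

      r⇒l : ∀ {j} → Occurs j r → Occurs j l
      r⇒l = Equivalence.from (vp eq∈ _)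

      restricted : Fin m → G
      restricted j with Occurs? j l
      ... | yes _ = lookup us j
      ... | no _  = p

      us′ : Vec G m
      us′ = tabulate restricted

      agrees : ∀ {j} → Occurs j l → lookup us j ≡ lookup us′ j
      agrees {j} j∈l rewrite lookup∘tabulate restricted j with Occurs? j l
      ... | yes _   = refl
      ... | no j∉l  = contradiction j∈l j∉l

      l-same : inst l us ≡ inst l us′
      l-same = ⟪⟫-cong-Occurs l agrees

      r-same : inst r us ≡ inst r us′
      r-same = ⟪⟫-cong-Occurs r (agrees ∘ r⇒l)

      occurring∈ : ∀ {j} → Occurs j l → lookup us j ∈ pqSubterms
      occurring∈ j∈l = [ (λ l-in → SubPQ-⊑ l-in (Occurs⇒⊑ (lookup us) j∈l))
                       , (λ r-in → SubPQ-⊑ r-in (Occurs⇒⊑ (lookup us) (l⇒r j∈l))) ]′ relevant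

      restricted∈ : ∀ j → lookup us′ j ∈ pqSubterms
      restricted∈ j rewrite lookup∘tabulate restricted j with Occurs? j l
      ... | yes j∈l = occurring∈ j∈l
      ... | no _    = ∈-++⁺ˡ (⊑⇒∈-subterms (self {s = p}))

    ∈-W₁⇔InW₁ : VarPreserving S → ∀ {e} → e ∈ W₁ ⇔ InW₁ S p q e
    ∈-W₁⇔InW₁ vp = mk⇔ ∈-collect⁻ λ { (_ , eq∈ , us , refl , relevant) → from {us = us} eq∈ relevant }
      where
      from : ∀ {eq us} → eq ∈ S → Relevant eq us → groundInstance eq us ∈ W₁
      from {us = us} eq∈ relevant
        with us′ , us′∈ , same , relevant′ ← restrict-substitution vp eq∈ {us} relevant =
        subst (_∈ W₁) (sym same) (∈-collect⁺ eq∈ (∈-vectorsOver us′∈) relevant′)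

  module NextSystem (S : TES Sig) (p q : G) (Wᵢ : GTES Sig) where

    open Automaton Sig Wᵢ p q

    tree : G → G
    tree = sel Wᵢ p q

    newInstance : (eq : Eqn Sig) → Vec G (proj₁ eq) × G → GEq Sig
    newInstance eq (as , _) = groundInstance eq (Vec.map tree as)

    Admissible : (eq : Eqn Sig) → Vec G (proj₁ eq) × G → Set
    Admissible (m , l , r) (as , a) =
      VAll.All (InT Wᵢ p q) as × InT Wᵢ p q a ×
      (Reach Wᵢ p q (l ⟪ (λ j → leaf (lookup as j)) ⟫) a ⊎
       Reach Wᵢ p q (r ⟪ (λ j → leaf (lookup as j)) ⟫) a) ×
      (ReachesFrom Wᵢ p q a p ⊎ ReachesFrom Wᵢ p q a q) ×
      ¬ Conv Wᵢ (inst l (Vec.map tree as)) (inst r (Vec.map tree as))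

    Admissible? : ∀ eq → Decidable (Admissible eq)
    Admissible? eq (as , a) =
      VAll.all? (InT? Wᵢ p q) as ×-dec InT? Wᵢ p q a ×-dec
      (Reach? _ a ⊎-dec Reach? _ a) ×-dec
      (ReachesFrom? a p ⊎-dec ReachesFrom? a q) ×-dec
      ¬? (Conv? _ _)

    candidates : (eq : Eqn Sig) → List (Vec G (proj₁ eq) × G)
    candidates eq = cartesianProduct (vectorsOver (states Wᵢ p q) (proj₁ eq)) (states Wᵢ p q)

    open Collect candidates newInstance Admissible?

    new : GTES Sig
    new = collect S

    ∈-new⇔NewEq : ∀ {e} → e ∈ new ⇔ NewEq sel S p q Wᵢ e
    ∈-new⇔NewEq = mk⇔
      (λ e∈ → case ∈-collect⁻ e∈ of λ
        { (eq , eq∈ , (as , a) , refl , (as∈ , a∈ , c₁ , c₂ , c₃)) →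
          eq , eq∈ , as , a , as∈ , a∈ , c₁ , c₂ , c₃ , refl })
      (λ { (eq , eq∈ , as , a , as∈ , a∈ , c₁ , c₂ , c₃ , refl) →
        ∈-collect⁺ eq∈ (∈-cartesianProduct⁺ (∈-vectorsOver (VAll.map ∈-states⁺ as∈)) (∈-states⁺ a∈))
          (as∈ , a∈ , c₁ , c₂ , c₃) })

  W : TES Sig → G → G → ℕ → GTES Sig
  W S p q zero          = []
  W S p q (suc zero)    = FirstSystem.W₁ S p q
  W S p q (suc (suc i)) = W S p q (suc i) ++ NextSystem.new S p q (W S p q (suc i))

mainTheorem8 : (Sig : RankedAlphabet) (sel : Selector {Sig}) → ValidSel sel →
    Σ[ W ∈ (TES Sig → GT Sig → GT Sig → ℕ → List (GEq Sig)) ]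
      (∀ (S : TES Sig) (p q : GT Sig) → VarPreserving S →
        (∀ e → (e ∈ W S p q 1) ⇔ InW₁ S p q e) ×
        (∀ i → 1 ≤ i → ∀ e →
          (e ∈ W S p q (suc i)) ⇔ ((e ∈ W S p q i) ⊎ NewEq sel S p q (W S p q i) e)))
mainTheorem8 Sig sel _ = W , λ S p q vp →
  (λ _ → FirstSystem.∈-W₁⇔InW₁ S p q vp) ,
  λ { (suc i) _ _ → ⇔.trans (⇔.sym (↔⇒⇔ ++↔))
                            (⇔.refl ⊎-⇔ NextSystem.∈-new⇔NewEq S p q (W S p q (suc i))) }
  where open Construction Sig sel
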